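{- Let $\mathcal{P}$ be a hereditary property of tournaments, and let $k, M \geq 0$ be integers. Suppose that for every $T \in \mathcal{P}$, the homogeneous block sequence $(t_1,t_2,\ldots)$ of $T$ satisfies $\sum_{i=k+2}^\infty t_i \leq M$. Then $|\mathcal{P}_n| = O(n^k)$.
   Context: Tournaments are unlabelled; a hereditary property is closed under isomorphism and induced sub-tournaments; $\mathcal{P}_n$ is the set of its members on $n$ vertices. In a tournament $T$, for vertices $u,v$ write $u \curvearrowright v$ if $u \to v$ and there exist $k \geq 0$ and vertices $w_1,\ldots,w_k$ such that, with $C = \{u,w_1,\ldots,w_k,v\}$: (i) $u \to w_i \to v$ for all $i$; (ii) $w_i \to w_j$ for $i<j$; (iii) for every $x \notin C$ and $y,z \in C$, $x \to y$ iff $x \to z$. Write $u \sim v$ if $u=v$, $u \curvearrowright v$ or $v \curvearrowright u$; this is an equivalence relation whose classes are the homogeneous blocks of $T$. The homogeneous block sequence of $T$ is $(t_1,t_2,\ldots)$ where $t_1 \ge t_2 \ge \cdots$ are the sizes of the homogeneous blocks of $T$, followed by zeros. -}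

module Defs where

open import Data.Nat using (ℕ; zero; suc; _≤_; _<_)
open import Data.Nat.Properties using (≤-decTotalOrder)
open import Data.Bool using (Bool; true; false)
open import Data.Fin using (Fin; _≟_) renaming (_<_ to _<ᶠ_)
open import Data.List using (List; length; filter; map; drop; allFin)
open import Data.Nat.ListAction using (sum)
open import Data.Product using (Σ; _×_; ∃)
open import Data.Sum using (_⊎_)
open import Relation.Binary.PropositionalEquality using (_≡_; _≢_)
open import Relation.Binary.Properties.DecTotalOrder ≤-decTotalOrder using (≥-decTotalOrder)
open import Function.Definitions using (Injective)
import Data.Empty
import Data.List.Sort

record Tournament (n : ℕ) : Set where
  field
    adj      : Fin n → Fin n → Bool
    loopless : ∀ u → adj u u ≡ false
    tourn    : ∀ u v → u ≢ v → (adj u v ≡ true × adj v u ≡ false) ⊎ (adj u v ≡ false × adj v u ≡ true)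
open Tournament public

_⟶_within_ : ∀ {n} → Fin n → Fin n → Tournament n → Set
u ⟶ v within T = adj T u v ≡ true

induced : ∀ {m n} (T : Tournament n) (f : Fin m → Fin n) → Injective _≡_ _≡_ f → Tournament m
induced T f inj = record
  { adj = λ u v → adj T (f u) (f v)
  ; loopless = λ u → loopless T (f u)
  ; tourn = λ u v u≢v → tourn T (f u) (f v) (λ e → u≢v (inj e))
  }

-- Isomorphism of tournaments on n vertices (an injective, hence bijective,
-- self-map of Fin n preserving the arc relation).
_≅_ : ∀ {n} → Tournament n → Tournament n → Set
_≅_ {n} S T = Σ (Fin n → Fin n) λ f → Injective _≡_ _≡_ f × (∀ u v → adj S u v ≡ adj T (f u) (f v))

Property : Set₁
Property = ∀ {n} → Tournament n → Set

-- Hereditary: closed under isomorphism and taking induced sub-tournaments.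
-- Both are captured by closure under pulling back along injections.
Hereditary : Property → Set
Hereditary P = ∀ {m n} (T : Tournament n) (f : Fin m → Fin n) (inj : Injective _≡_ _≡_ f) → P T → P (induced T f inj)

module _ {n : ℕ} (T : Tournament n) where

  InC : ∀ {k} → Fin n → Fin n → (Fin k → Fin n) → Fin n → Set
  InC u v w y = y ≡ u ⊎ y ≡ v ⊎ ∃ λ i → y ≡ w i

  _↷_ : Fin n → Fin n → Set
  u ↷ v = Σ ℕ λ k → Σ (Fin k → Fin n) λ w →
      (u ⟶ v within T)
    × (∀ i → (u ⟶ w i within T) × (w i ⟶ v within T))
    × (∀ i j → i <ᶠ j → w i ⟶ w j within T)
    × (∀ x y z → (InC u v w x → Data.Empty.⊥) → InC u v w y → InC u v w z →
         (x ⟶ y within T → x ⟶ z within T) × (x ⟶ z within T → x ⟶ y within T))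

  _∼_ : Fin n → Fin n → Set
  u ∼ v = u ≡ v ⊎ u ↷ v ⊎ v ↷ u

  -- A labelling b : Fin n → Fin m whose fibres are exactly the ∼-classes,
  -- i.e. whose nonempty fibres are exactly the homogeneous blocks of T.
  BlockLabelling : ∀ {m} → (Fin n → Fin m) → Set
  BlockLabelling b = ∀ u v → (b u ≡ b v → u ∼ v) × (u ∼ v → b u ≡ b v)

fibreSize : ∀ {n m} → (Fin n → Fin m) → Fin m → ℕ
fibreSize {n} b j = length (filter (λ v → b v ≟ j) (allFin n))

open Data.List.Sort ≥-decTotalOrder using (sort)

-- Sizes of the fibres of b sorted in non-increasing order: given a block
-- labelling this is (t₁, t₂, …) (padded with some zeros, coming from empty
-- fibres; the sequence is followed by zeros anyway).
blockSequence : ∀ {n m} → (Fin n → Fin m) → List ℕ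
blockSequence {m = m} b = sort (map (fibreSize b) (allFin m))

-- ∑_{i = k+2}^∞ t_i
tailSum : ℕ → List ℕ → ℕ
tailSum k ts = sum (drop (suc k) ts)

module Submission where

-- Lying in a common transitive module (a vertex set inducing a transitive tournament that every
-- outside vertex sees uniformly) is a decidable equivalence whose classes are the homogeneous
-- blocks. Numbering the vertices block by block, each block in its transitive order, shows that a
-- tournament is determined up to isomorphism by its list of block sizes and the arcs between block
-- representatives. Blocks are nonempty and those beyond the k + 1 largest have total size at most
-- M, so there are at most R = k + 1 + M blocks, at most k + 1 of them larger than M. Clearing one
-- block larger than M (its size is n minus the others) leaves a size vector with at most k entries
-- in (M, n] and the rest in [0, M]: at most (M + 2)^R n^k choices, against a bounded number of
-- block counts, cleared positions and tables of arcs between blocks.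

open import Defs
open import Data.Bool using (Bool; true; false; not; _∧_; _∨_; if_then_else_) renaming (_≟_ to _≟ᵇ_)
import Data.Bool.Properties as Boolᵖ
open import Data.Empty using (⊥)
open import Data.Fin using (Fin; zero; suc; toℕ; fromℕ<; _≟_) renaming (_<_ to _<ᶠ_)
open import Data.Fin.Properties using (toℕ<n; toℕ-injective; toℕ-fromℕ<; all?; any?) renaming (suc-injective to Fin-suc-injective)
open import Data.List
  using (List; []; _∷_; length; lookup; map; filter; take; drop; tabulate; allFin; _++_; concatMap; cartesianProductWith; downFrom)
open import Data.List.Properties
  using (length-map; length-++; length-downFrom; length-tabulate; filter-accept; filter-reject)
open import Data.List.Membership.Propositional using (_∈_)
open import Data.List.Membership.Propositional.Properties
  using (∈-allFin; ∈-lookup; ∈-filter⁺; ∈-++⁺ˡ; ∈-++⁺ʳ; ∈-map⁺; ∈-concatMap⁺; ∈-downFrom⁺; ∈-downFrom⁻; ∈-cartesianProductWith⁺)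
open import Data.List.Relation.Binary.Permutation.Propositional using (_↭_; ↭-sym)
open import Data.List.Relation.Binary.Permutation.Propositional.Properties using (↭-length; filter-↭; All-resp-↭)
open import Data.List.Relation.Unary.All as All using (All; []; _∷_)
open import Data.List.Relation.Unary.All.Properties using (all-filter; map⁺; tabulate⁺)
open import Data.List.Relation.Unary.AllPairs using (AllPairs; []; _∷_)
open import Data.List.Relation.Unary.Any as Any using (Any; here; there)
open import Data.List.Relation.Unary.Any.Properties using (lookup-index)
open import Data.Nat using (ℕ; zero; suc; pred; _+_; _∸_; _*_; _^_; _≤_; _<_; _<?_; z≤n; s≤s; s≤s⁻¹; >-nonZero)
open import Data.Nat.Properties hiding (_≟_)
import Data.Nat.Properties as ℕᵖ
open import Algebra.Properties.CommutativeMonoid.Sum +-0-commutativeMonoid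
  using (sum-syntax; ∑-comm; sum-cong-≗; sum-replicate-zero)
open import Data.Nat.ListAction using (sum)
open import Data.Nat.Tactic.RingSolver using (solve-∀)
open import Data.Product using (Σ; _×_; _,_; proj₁; proj₂)
open import Data.Sum using (_⊎_; inj₁; inj₂)
open import Function using (_∘_; _on_; id)
open import Function.Definitions using (Injective)
open import Relation.Binary using (Rel; IsDecEquivalence; tri<; tri≈; tri>)
import Relation.Binary.Construct.On as On
open import Relation.Binary.PropositionalEquality
open import Relation.Binary.Properties.DecTotalOrder ≤-decTotalOrder using (≥-decTotalOrder)
open import Data.List.Sort ≥-decTotalOrder using (sort; sort-↭)
open import Relation.Nullary using (¬_; Dec; yes; no; does; contradiction)
open import Relation.Nullary.Decidable using (dec-true; dec-false; _×-dec_; _→-dec_; _⊎-dec_; map′)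
open import Relation.Unary using (Pred; Decidable)

true≢false : true ≢ false
true≢false ()

bool-≡ : ∀ {a b : Bool} → (a ≡ true → b ≡ true) → (b ≡ true → a ≡ true) → a ≡ b
bool-≡ {true} a⇒b _ = sym (a⇒b refl)
bool-≡ {false} {true} _ b⇒a = b⇒a refl
bool-≡ {false} {false} _ _ = refl

bool-cases : ∀ b → b ≡ true ⊎ b ≡ false
bool-cases true = inj₁ refl
bool-cases false = inj₂ refl

∧-true : ∀ {a b} → a ∧ b ≡ true → a ≡ true × b ≡ true
∧-true {true} b≡true = refl , b≡true

∧-intro : ∀ {a b} → a ≡ true → b ≡ true → a ∧ b ≡ true
∧-intro refl refl = refl

does-true : ∀ {a} {A : Set a} (a? : Dec A) → does a? ≡ true → A
does-true (yes a) _ = a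

-- Counting over Fin n

indicator : Bool → ℕ
indicator b = if b then 1 else 0

indicator≤1 : ∀ b → indicator b ≤ 1
indicator≤1 true = ≤-refl
indicator≤1 false = z≤n

indicator-mono : ∀ {a b} → (a ≡ true → b ≡ true) → indicator a ≤ indicator b
indicator-mono {false} _ = z≤n
indicator-mono {true} a⇒b rewrite a⇒b refl = ≤-refl

count : ∀ {n} → (Fin n → Bool) → ℕ
count {n} p = ∑[ i < n ] indicator (p i)

∑-mono-≤ : ∀ {n} (f g : Fin n → ℕ) → (∀ i → f i ≤ g i) → ∑[ i < n ] f i ≤ ∑[ i < n ] g i
∑-mono-≤ {zero} f g f≤g = z≤n
∑-mono-≤ {suc n} f g f≤g = +-mono-≤ (f≤g zero) (∑-mono-≤ (f ∘ suc) (g ∘ suc) (f≤g ∘ suc))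

∑-mono-< : ∀ {n} (f g : Fin n → ℕ) → (∀ i → f i ≤ g i) → ∀ j → f j < g j → ∑[ i < n ] f i < ∑[ i < n ] g i
∑-mono-< f g f≤g zero fj<gj = +-mono-<-≤ fj<gj (∑-mono-≤ (f ∘ suc) (g ∘ suc) (f≤g ∘ suc))
∑-mono-< f g f≤g (suc j) fj<gj = +-mono-≤-< (f≤g zero) (∑-mono-< (f ∘ suc) (g ∘ suc) (f≤g ∘ suc) j fj<gj)

∑-le-term : ∀ {n} (f : Fin n → ℕ) j → f j ≤ ∑[ i < n ] f i
∑-le-term f zero = m≤m+n _ _
∑-le-term f (suc j) = ≤-trans (∑-le-term (f ∘ suc) j) (m≤n+m _ _)

∑-one : ∀ n → ∑[ i < n ] 1 ≡ n
∑-one zero = refl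
∑-one (suc n) = cong suc (∑-one n)

count-mono-< : ∀ {n} {p q : Fin n → Bool} → (∀ i → p i ≡ true → q i ≡ true) →
               ∀ j → p j ≡ false → q j ≡ true → count p < count q
count-mono-< {p = p} {q} p⊆q j pj qj =
  ∑-mono-< _ _ (λ i → indicator-mono (p⊆q i)) j (subst₂ (λ a b → indicator a < indicator b) (sym pj) (sym qj) ≤-refl)

count≤ : ∀ {n} (p : Fin n → Bool) → count p ≤ n
count≤ {n} p = subst (count p ≤_) (∑-one n) (∑-mono-≤ _ _ (λ i → indicator≤1 (p i)))

count-pos : ∀ {n} (p : Fin n → Bool) j → p j ≡ true → 0 < count p
count-pos p j pj = ≤-trans (≤-reflexive (cong indicator (sym pj))) (∑-le-term (indicator ∘ p) j)

length-filter-tabulate : ∀ {a n} {A : Set a} {P : Pred A a} (P? : Decidable P) (g : Fin n → A) →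
                         length (filter P? (tabulate g)) ≡ count (does ∘ P? ∘ g)
length-filter-tabulate {n = zero} P? g = refl
length-filter-tabulate {n = suc n} P? g with does (P? (g zero))
... | true = cong suc (length-filter-tabulate P? (g ∘ suc))
... | false = length-filter-tabulate P? (g ∘ suc)

count-≡ : ∀ {m} (a : Fin m) → count (λ j → does (a ≟ j)) ≡ 1
count-≡ {suc m} zero = cong suc (sum-replicate-zero m)
count-≡ (suc a) = count-≡ a

count-fibres : ∀ {n m} (b : Fin n → Fin m) → ∑[ j < m ] count (λ v → does (b v ≟ j)) ≡ n
count-fibres {n} {m} b = begin
  ∑[ j < m ] ∑[ v < n ] indicator (does (b v ≟ j)) ≡⟨ ∑-comm (λ j v → indicator (does (b v ≟ j))) ⟩
  ∑[ v < n ] ∑[ j < m ] indicator (does (b v ≟ j)) ≡⟨ sum-cong-≗ (count-≡ ∘ b) ⟩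
  ∑[ v < n ] 1                                     ≡⟨ ∑-one n ⟩
  n                                                ∎
  where open ≡-Reasoning

-- Quotients of Fin n by a decidable equivalence

record Quotient {n ℓ} (_≈_ : Rel (Fin n) ℓ) : Set ℓ where
  field
    size                 : ℕ
    class                : Fin n → Fin size
    representative       : Fin size → Fin n
    class-representative : ∀ j → class (representative j) ≡ j
    class-≡⇔≈            : ∀ u v → (class u ≡ class v → u ≈ v) × (u ≈ v → class u ≡ class v)

module QuotientExtension {n ℓ} {_≈_ : Rel (Fin (suc n)) ℓ} (≈-isDecEq : IsDecEquivalence _≈_)
                         (Q : Quotient (_≈_ on suc)) where
  open IsDecEquivalence ≈-isDecEq using () renaming (_≟_ to _≈?_; refl to ≈-refl; sym to ≈-sym; trans to ≈-trans)
  open Quotient Q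

  private
    class⇒≈ : ∀ u v → class u ≡ class v → suc u ≈ suc v
    class⇒≈ u v = proj₁ (class-≡⇔≈ u v)

    ≈⇒class : ∀ u v → suc u ≈ suc v → class u ≡ class v
    ≈⇒class u v = proj₂ (class-≡⇔≈ u v)

  joining : ∀ v → zero ≈ suc v → Quotient _≈_
  joining v 0≈v = record
    { size = size
    ; class = λ { zero → class v ; (suc u) → class u }
    ; representative = suc ∘ representative
    ; class-representative = class-representative
    ; class-≡⇔≈ = λ
      { zero zero → (λ _ → ≈-refl) , (λ _ → refl)
      ; zero (suc u) → (λ e → ≈-trans 0≈v (class⇒≈ v u e)) , (λ 0≈u → ≈⇒class v u (≈-trans (≈-sym 0≈v) 0≈u))
      ; (suc u) zero → (λ e → ≈-sym (≈-trans 0≈v (class⇒≈ v u (sym e))))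
                     , (λ u≈0 → sym (≈⇒class v u (≈-trans (≈-sym 0≈v) (≈-sym u≈0))))
      ; (suc u) (suc w) → class-≡⇔≈ u w
      }
    }

  fresh : (∀ v → ¬ zero ≈ suc v) → Quotient _≈_
  fresh 0≉ = record
    { size = suc size
    ; class = λ { zero → zero ; (suc u) → suc (class u) }
    ; representative = λ { zero → zero ; (suc j) → suc (representative j) }
    ; class-representative = λ { zero → refl ; (suc j) → cong suc (class-representative j) }
    ; class-≡⇔≈ = λ
      { zero zero → (λ _ → ≈-refl) , (λ _ → refl)
      ; zero (suc u) → (λ ()) , (λ 0≈u → contradiction 0≈u (0≉ u))
      ; (suc u) zero → (λ ()) , (λ u≈0 → contradiction (≈-sym u≈0) (0≉ u))
      ; (suc u) (suc w) → (class⇒≈ u w ∘ Fin-suc-injective) , (cong suc ∘ ≈⇒class u w)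
      }
    }

  extend : Quotient _≈_
  extend with any? (λ v → zero ≈? suc v)
  ... | yes (v , 0≈v) = joining v 0≈v
  ... | no ∄v = fresh (λ v 0≈v → ∄v (v , 0≈v))

quotient : ∀ {n ℓ} {_≈_ : Rel (Fin n) ℓ} → IsDecEquivalence _≈_ → Quotient _≈_
quotient {zero} _ = record
  { size = 0 ; class = λ () ; representative = λ () ; class-representative = λ () ; class-≡⇔≈ = λ () }
quotient {suc n} ≈-isDecEq = QuotientExtension.extend ≈-isDecEq (quotient (On.isDecEquivalence suc ≈-isDecEq))

-- Transitive modules and homogeneous blocks

module Blocks {n : ℕ} (T : Tournament n) where

  A : Fin n → Fin n → Bool
  A = adj T

  arc-flip : ∀ a b → a ≢ b → A b a ≡ not (A a b)
  arc-flip a b a≢b with tourn T a b a≢b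
  ... | inj₁ (ab , ba) = trans ba (cong not (sym ab))
  ... | inj₂ (ab , ba) = trans ba (cong not (sym ab))

  arc-irrefl : ∀ {a b} → A a b ≡ true → a ≢ b
  arc-irrefl {a} ab refl = true≢false (trans (sym ab) (loopless T a))

  arc-asym : ∀ {a b} → A a b ≡ true → A b a ≡ false
  arc-asym {a} {b} ab = trans (arc-flip a b (arc-irrefl ab)) (cong not ab)

  arc-total : ∀ {a b} → a ≢ b → A a b ≡ false → A b a ≡ true
  arc-total {a} {b} a≢b ab = trans (arc-flip a b a≢b) (cong not ab)

  IsTransitiveOn : (Fin n → Bool) → Set
  IsTransitiveOn S = ∀ x y z → S x ≡ true → S y ≡ true → S z ≡ true →
                     A x y ≡ true → A y z ≡ true → A x z ≡ true

  IsModule : (Fin n → Bool) → Set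
  IsModule S = ∀ x y z → S x ≡ false → S y ≡ true → S z ≡ true → A x y ≡ A x z

  IsTransitiveModule : (Fin n → Bool) → Set
  IsTransitiveModule S = IsTransitiveOn S × IsModule S

  isTransitiveModule? : ∀ S → Dec (IsTransitiveModule S)
  isTransitiveModule? S = transitive? ×-dec module?
    where
    transitive? : Dec (IsTransitiveOn S)
    transitive? = all? λ x → all? λ y → all? λ z →
      (S x ≟ᵇ true) →-dec (S y ≟ᵇ true) →-dec (S z ≟ᵇ true) →-dec
      (A x y ≟ᵇ true) →-dec (A y z ≟ᵇ true) →-dec (A x z ≟ᵇ true)
    module? : Dec (IsModule S)
    module? = all? λ x → all? λ y → all? λ z →
      (S x ≟ᵇ false) →-dec (S y ≟ᵇ true) →-dec (S z ≟ᵇ true) →-dec (A x y ≟ᵇ A x z)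

  between : Fin n → Fin n → Fin n → Bool
  between u v x = A u x ∧ A x v

  interval : Fin n → Fin n → Fin n → Bool
  interval u v x = does (x ≟ u) ∨ does (x ≟ v) ∨ between u v x

  data InInterval (u v x : Fin n) : Set where
    left  : x ≡ u → InInterval u v x
    right : x ≡ v → InInterval u v x
    inner : A u x ≡ true → A x v ≡ true → InInterval u v x

  interval-view : ∀ {u v x} → interval u v x ≡ true → InInterval u v x
  interval-view {u} {v} {x} x∈ with x ≟ u | x ≟ v
  ... | yes x≡u | _ = left x≡u
  ... | no _ | yes x≡v = right x≡v
  ... | no _ | no _ = let ux , xv = ∧-true x∈ in inner ux xv

  interval-intro : ∀ {u v x} → InInterval u v x → interval u v x ≡ true
  interval-intro {u} {v} {x} (left x≡u) rewrite dec-true (x ≟ u) x≡u = refl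
  interval-intro {u} {v} {x} (right x≡v) rewrite dec-true (x ≟ v) x≡v = Boolᵖ.∨-zeroʳ (does (x ≟ u))
  interval-intro {u} {v} {x} (inner ux xv) rewrite ux | xv =
    trans (cong (does (x ≟ u) ∨_) (Boolᵖ.∨-zeroʳ (does (x ≟ v)))) (Boolᵖ.∨-zeroʳ (does (x ≟ u)))

  between⇒interval : ∀ {u v x} → between u v x ≡ true → interval u v x ≡ true
  between⇒interval ux∧xv = let ux , xv = ∧-true ux∧xv in interval-intro (inner ux xv)

  left∈interval : ∀ u v → interval u v u ≡ true
  left∈interval u v = interval-intro {u} {v} (left refl)

  right∈interval : ∀ u v → interval u v v ≡ true
  right∈interval u v = interval-intro {u} {v} (right refl)

  interval-outside : ∀ {u v x} → interval u v x ≡ false → ¬ InInterval u v x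
  interval-outside x∉ x∈ = true≢false (trans (sym (interval-intro x∈)) x∉)

  -- In u ↷ v the set C is forced to be the interval: an outside x with u → x → v would
  -- distinguish u from v.
  TransitiveInterval : Fin n → Fin n → Set
  TransitiveInterval u v = A u v ≡ true × IsTransitiveModule (interval u v)

  transitiveInterval? : ∀ u v → Dec (TransitiveInterval u v)
  transitiveInterval? u v = (A u v ≟ᵇ true) ×-dec isTransitiveModule? (interval u v)

  module _ {u v : Fin n} {k : ℕ} (w : Fin k → Fin n) (uv : A u v ≡ true)
           (u→w→v : ∀ i → (A u (w i) ≡ true) × (A (w i) v ≡ true))
           (w-increasing : ∀ i j → i <ᶠ j → A (w i) (w j) ≡ true)
           (C-module : ∀ x y z → (InC T u v w x → ⊥) → InC T u v w y → InC T u v w z →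
                       (A x y ≡ true → A x z ≡ true) × (A x z ≡ true → A x y ≡ true)) where

    private
      C : Fin n → Set
      C = InC T u v w

      position : ∀ {x} → C x → ℕ
      position (inj₁ _) = 0
      position (inj₂ (inj₁ _)) = suc k
      position (inj₂ (inj₂ (i , _))) = suc (toℕ i)

      position-<⇒arc : ∀ {x y} (x∈ : C x) (y∈ : C y) → position x∈ < position y∈ → A x y ≡ true
      position-<⇒arc (inj₁ refl) (inj₂ (inj₁ refl)) _ = uv
      position-<⇒arc (inj₁ refl) (inj₂ (inj₂ (j , refl))) _ = proj₁ (u→w→v j)
      position-<⇒arc (inj₂ (inj₁ refl)) (inj₂ (inj₁ refl)) k<k = contradiction k<k (n≮n _)
      position-<⇒arc (inj₂ (inj₁ refl)) (inj₂ (inj₂ (j , refl))) (s≤s k<j) = contradiction (toℕ<n j) (<-asym k<j)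
      position-<⇒arc (inj₂ (inj₂ (i , refl))) (inj₂ (inj₁ refl)) _ = proj₂ (u→w→v i)
      position-<⇒arc (inj₂ (inj₂ (i , refl))) (inj₂ (inj₂ (j , refl))) (s≤s i<j) = w-increasing i j i<j

      position-injective : ∀ {x y} (x∈ : C x) (y∈ : C y) → position x∈ ≡ position y∈ → x ≡ y
      position-injective (inj₁ refl) (inj₁ refl) _ = refl
      position-injective (inj₁ _) (inj₂ (inj₁ _)) ()
      position-injective (inj₁ _) (inj₂ (inj₂ _)) ()
      position-injective (inj₂ (inj₁ _)) (inj₁ _) ()
      position-injective (inj₂ (inj₂ _)) (inj₁ _) ()
      position-injective (inj₂ (inj₁ refl)) (inj₂ (inj₁ refl)) _ = refl
      position-injective (inj₂ (inj₁ refl)) (inj₂ (inj₂ (j , refl))) k≡j = contradiction (toℕ<n j) (<-irrefl (sym (cong pred k≡j)))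
      position-injective (inj₂ (inj₂ (i , refl))) (inj₂ (inj₁ refl)) i≡k = contradiction (toℕ<n i) (<-irrefl (cong pred i≡k))
      position-injective (inj₂ (inj₂ (i , refl))) (inj₂ (inj₂ (j , refl))) i≡j = cong w (toℕ-injective (cong pred i≡j))

      arc⇒position-< : ∀ {x y} (x∈ : C x) (y∈ : C y) → A x y ≡ true → position x∈ < position y∈
      arc⇒position-< x∈ y∈ xy with <-cmp (position x∈) (position y∈)
      ... | tri< lt _ _ = lt
      ... | tri≈ _ eq _ = contradiction (position-injective x∈ y∈ eq) (arc-irrefl xy)
      ... | tri> _ _ gt = contradiction (trans (sym (position-<⇒arc y∈ x∈ gt)) (arc-asym xy)) true≢false

      C? : ∀ x → Dec (C x)
      C? x = (x ≟ u) ⊎-dec ((x ≟ v) ⊎-dec any? (λ i → x ≟ w i))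

      interval⇒C : ∀ {x} → interval u v x ≡ true → C x
      interval⇒C {x} x∈ with interval-view x∈
      ... | left x≡u = inj₁ x≡u
      ... | right x≡v = inj₂ (inj₁ x≡v)
      ... | inner ux xv with C? x
      ...   | yes x∈C = x∈C
      ...   | no x∉C = contradiction (trans (sym (proj₂ (C-module x u v x∉C (inj₁ refl) (inj₂ (inj₁ refl))) xv)) (arc-asym ux)) true≢false

      C⇒interval : ∀ {x} → C x → interval u v x ≡ true
      C⇒interval (inj₁ x≡u) = interval-intro (left x≡u)
      C⇒interval (inj₂ (inj₁ x≡v)) = interval-intro (right x≡v)
      C⇒interval (inj₂ (inj₂ (i , refl))) = interval-intro (inner (proj₁ (u→w→v i)) (proj₂ (u→w→v i)))

    witnesses⇒transitiveInterval : TransitiveInterval u v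
    witnesses⇒transitiveInterval = uv , transitive , module′
      where
      transitive : IsTransitiveOn (interval u v)
      transitive x y z x∈ y∈ z∈ xy yz = position-<⇒arc (interval⇒C x∈) (interval⇒C z∈)
        (<-trans (arc⇒position-< (interval⇒C x∈) (interval⇒C y∈) xy) (arc⇒position-< (interval⇒C y∈) (interval⇒C z∈) yz))
      module′ : IsModule (interval u v)
      module′ x y z x∉ y∈ z∈ =
        let y⇔z = C-module x y z (λ x∈ → true≢false (trans (sym (C⇒interval x∈)) x∉)) (interval⇒C y∈) (interval⇒C z∈)
        in bool-≡ (proj₁ y⇔z) (proj₂ y⇔z)

  ↷⇒transitiveInterval : ∀ {u v} → _↷_ T u v → TransitiveInterval u v
  ↷⇒transitiveInterval (_ , w , uv , u→w→v , w-increasing , C-module) =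
    witnesses⇒transitiveInterval w uv u→w→v w-increasing C-module

  insert : Fin n → List (Fin n) → List (Fin n)
  insert x [] = x ∷ []
  insert x (y ∷ ys) with A x y | does (x ≟ y)
  ... | true  | _     = x ∷ y ∷ ys
  ... | false | true  = y ∷ ys
  ... | false | false = y ∷ insert x ys

  sortByArcs : List (Fin n) → List (Fin n)
  sortByArcs [] = []
  sortByArcs (x ∷ xs) = insert x (sortByArcs xs)

  insert-All : ∀ {P : Fin n → Set} {x} ys → P x → All P ys → All P (insert x ys)
  insert-All [] px [] = px ∷ []
  insert-All {x = x} (y ∷ ys) px (py ∷ pys) with A x y | does (x ≟ y)
  ... | true  | _     = px ∷ py ∷ pys
  ... | false | true  = py ∷ pys
  ... | false | false = py ∷ insert-All ys px pys

  ∈-insert-self : ∀ x ys → x ∈ insert x ys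
  ∈-insert-self x [] = here refl
  ∈-insert-self x (y ∷ ys) with A x y | x ≟ y
  ... | true  | _        = here refl
  ... | false | yes x≡y  = here x≡y
  ... | false | no _     = there (∈-insert-self x ys)

  ∈-insert : ∀ x ys {z} → z ∈ ys → z ∈ insert x ys
  ∈-insert x (y ∷ ys) z∈ with A x y | does (x ≟ y) | z∈
  ... | true  | _     | _         = there z∈
  ... | false | true  | _         = z∈
  ... | false | false | here z≡y  = here z≡y
  ... | false | false | there z∈′ = there (∈-insert x ys z∈′)

  insert-AllPairs : ∀ S → IsTransitiveOn S → ∀ {x} ys → S x ≡ true → All (λ y → S y ≡ true) ys →
                    AllPairs (λ a b → A a b ≡ true) ys → AllPairs (λ a b → A a b ≡ true) (insert x ys)
  insert-AllPairs S trans-S [] _ [] [] = [] ∷ []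
  insert-AllPairs S trans-S {x} (y ∷ ys) x∈S (y∈S ∷ ys⊆S) (y→ys ∷ sorted) with A x y in xy | x ≟ y
  ... | true  | _       = (xy ∷ All.zipWith (λ (z∈S , yz) → trans-S x y _ x∈S y∈S z∈S xy yz) (ys⊆S , y→ys)) ∷ y→ys ∷ sorted
  ... | false | yes _   = y→ys ∷ sorted
  ... | false | no x≢y  = insert-All ys (arc-total x≢y xy) y→ys ∷ insert-AllPairs S trans-S ys x∈S ys⊆S sorted

  sortByArcs-All : ∀ {P : Fin n → Set} xs → All P xs → All P (sortByArcs xs)
  sortByArcs-All [] [] = []
  sortByArcs-All (x ∷ xs) (px ∷ pxs) = insert-All (sortByArcs xs) px (sortByArcs-All xs pxs)

  ∈-sortByArcs : ∀ xs {z} → z ∈ xs → z ∈ sortByArcs xs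
  ∈-sortByArcs (x ∷ xs) (here refl) = ∈-insert-self x (sortByArcs xs)
  ∈-sortByArcs (x ∷ xs) (there z∈) = ∈-insert x (sortByArcs xs) (∈-sortByArcs xs z∈)

  sortByArcs-AllPairs : ∀ S → IsTransitiveOn S → ∀ xs → All (λ y → S y ≡ true) xs →
                        AllPairs (λ a b → A a b ≡ true) (sortByArcs xs)
  sortByArcs-AllPairs S trans-S [] [] = []
  sortByArcs-AllPairs S trans-S (x ∷ xs) (x∈S ∷ xs⊆S) =
    insert-AllPairs S trans-S (sortByArcs xs) x∈S (sortByArcs-All xs xs⊆S) (sortByArcs-AllPairs S trans-S xs xs⊆S)

  AllPairs-lookup : ∀ {R : Fin n → Fin n → Set} {xs} → AllPairs R xs →
                    ∀ i j → i <ᶠ j → R (lookup xs i) (lookup xs j)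
  AllPairs-lookup (x→xs ∷ _) zero (suc j) _ = All.lookup x→xs (∈-lookup j)
  AllPairs-lookup (_ ∷ sorted) (suc i) (suc j) (s≤s i<j) = AllPairs-lookup sorted i j i<j

  transitiveInterval⇒↷ : ∀ {u v} → TransitiveInterval u v → _↷_ T u v
  transitiveInterval⇒↷ {u} {v} (uv , trans-I , module-I) =
    length ws , lookup ws , uv , u→w→v , w-increasing , C-module
    where
    between? : ∀ x → Dec (between u v x ≡ true)
    between? x = between u v x ≟ᵇ true
    inner-vertices : List (Fin n)
    inner-vertices = filter between? (allFin n)
    ws : List (Fin n)
    ws = sortByArcs inner-vertices
    ws-between : All (λ x → between u v x ≡ true) ws
    ws-between = sortByArcs-All inner-vertices (all-filter between? (allFin n))
    u→w→v : ∀ i → (A u (lookup ws i) ≡ true) × (A (lookup ws i) v ≡ true)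
    u→w→v i = ∧-true (All.lookup ws-between (∈-lookup i))
    w-increasing : ∀ i j → i <ᶠ j → A (lookup ws i) (lookup ws j) ≡ true
    w-increasing = AllPairs-lookup (sortByArcs-AllPairs (interval u v) trans-I inner-vertices
      (All.map between⇒interval (all-filter between? (allFin n))))
    C⇒interval : ∀ {y} → InC T u v (lookup ws) y → interval u v y ≡ true
    C⇒interval (inj₁ y≡u) = interval-intro (left y≡u)
    C⇒interval (inj₂ (inj₁ y≡v)) = interval-intro (right y≡v)
    C⇒interval (inj₂ (inj₂ (i , refl))) = between⇒interval (All.lookup ws-between (∈-lookup i))
    ∉C⇒∉interval : ∀ {x} → ¬ InC T u v (lookup ws) x → interval u v x ≡ false
    ∉C⇒∉interval {x} x∉C with bool-cases (interval u v x)
    ... | inj₂ x∉I = x∉I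
    ... | inj₁ x∈I with interval-view x∈I
    ...   | left x≡u = contradiction (inj₁ x≡u) x∉C
    ...   | right x≡v = contradiction (inj₂ (inj₁ x≡v)) x∉C
    ...   | inner ux xv = contradiction (inj₂ (inj₂ (Any.index x∈ws , lookup-index x∈ws))) x∉C
      where
      x∈ws : x ∈ ws
      x∈ws = ∈-sortByArcs inner-vertices (∈-filter⁺ between? (∈-allFin x) (∧-intro ux xv))
    C-module : ∀ x y z → ¬ InC T u v (lookup ws) x → InC T u v (lookup ws) y → InC T u v (lookup ws) z →
               (A x y ≡ true → A x z ≡ true) × (A x z ≡ true → A x y ≡ true)
    C-module x y z x∉C y∈C z∈C =
      let xy≡xz = module-I x y z (∉C⇒∉interval x∉C) (C⇒interval y∈C) (C⇒interval z∈C)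
      in trans (sym xy≡xz) , trans xy≡xz

  transitiveModule⇒transitiveInterval : ∀ S → IsTransitiveModule S → ∀ {u v} →
    S u ≡ true → S v ≡ true → A u v ≡ true → TransitiveInterval u v
  transitiveModule⇒transitiveInterval S (trans-S , module-S) {u} {v} u∈S v∈S uv = uv , trans-I , module-I
    where
    I⊆S : ∀ {x} → interval u v x ≡ true → S x ≡ true
    I⊆S {x} x∈I with interval-view {u} {v} {x} x∈I
    ... | left refl = u∈S
    ... | right refl = v∈S
    ... | inner ux xv with bool-cases (S x)
    ...   | inj₁ x∈S = x∈S
    ...   | inj₂ x∉S = contradiction (trans (sym (trans (module-S x u v x∉S u∈S v∈S) xv)) (arc-asym ux)) true≢false
    trans-I : IsTransitiveOn (interval u v)
    trans-I x y z x∈ y∈ z∈ = trans-S x y z (I⊆S x∈) (I⊆S y∈) (I⊆S z∈)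
    module-I : IsModule (interval u v)
    module-I x y z x∉I y∈I z∈I with bool-cases (S x)
    ... | inj₂ x∉S = module-S x y z x∉S (I⊆S y∈I) (I⊆S z∈I)
    ... | inj₁ x∈S = trans (sees-as-u y∈I) (sym (sees-as-u z∈I))
      where
      x≢u : x ≢ u
      x≢u x≡u = interval-outside x∉I (left x≡u)
      x≢v : x ≢ v
      x≢v x≡v = interval-outside x∉I (right x≡v)
      sees-as-u : ∀ {y} → interval u v y ≡ true → A x y ≡ A x u
      sees-as-u {y} y∈I with bool-cases (A x u) | interval-view {u} {v} {y} y∈I
      ... | _         | left refl = refl
      ... | inj₁ xu   | right refl = trans (trans-S x u v x∈S u∈S v∈S xu uv) (sym xu)
      ... | inj₁ xu   | inner uy yv = trans (trans-S x u y x∈S u∈S (I⊆S y∈I) xu uy) (sym xu)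
      ... | inj₂ x↛u | y-in with bool-cases (A x v)
      ...   | inj₁ xv = contradiction (inner (arc-total x≢u x↛u) xv) (interval-outside x∉I)
      ...   | inj₂ x↛v with y-in
      ...     | left refl = refl
      ...     | right refl = trans x↛v (sym x↛u)
      ...     | inner uy yv = trans (arc-asym (trans-S y v x (I⊆S y∈I) v∈S x∈S yv (arc-total x≢v x↛v))) (sym x↛u)

  _∪_ : (Fin n → Bool) → (Fin n → Bool) → Fin n → Bool
  (S₁ ∪ S₂) x = S₁ x ∨ S₂ x

  data ∪-View (S₁ S₂ : Fin n → Bool) (x : Fin n) : Set where
    in₁ : S₁ x ≡ true → ∪-View S₁ S₂ x
    in₂ : S₁ x ≡ false → S₂ x ≡ true → ∪-View S₁ S₂ x

  ∪-view : ∀ S₁ S₂ {x} → (S₁ ∪ S₂) x ≡ true → ∪-View S₁ S₂ x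
  ∪-view S₁ S₂ {x} x∈ with S₁ x in x∈₁
  ... | true = in₁ x∈₁
  ... | false = in₂ x∈₁ x∈

  ∉-∪ : ∀ S₁ S₂ {x} → (S₁ ∪ S₂) x ≡ false → S₁ x ≡ false × S₂ x ≡ false
  ∉-∪ S₁ S₂ {x} x∉ with S₁ x
  ... | false = refl , x∉

  ∪-transitiveModule : ∀ S₁ S₂ → IsTransitiveModule S₁ → IsTransitiveModule S₂ →
                       ∀ c → S₁ c ≡ true → S₂ c ≡ true → IsTransitiveModule (S₁ ∪ S₂)
  ∪-transitiveModule S₁ S₂ (trans₁ , module₁) (trans₂ , module₂) c c∈₁ c∈₂ = trans-∪ , module-∪
    where
    module-∪ : IsModule (S₁ ∪ S₂)
    module-∪ x y z x∉ y∈ z∈ = trans (sees-as-c y∈) (sym (sees-as-c z∈))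
      where
      sees-as-c : ∀ {y} → (S₁ ∪ S₂) y ≡ true → A x y ≡ A x c
      sees-as-c y∈ with ∪-view S₁ S₂ y∈
      ... | in₁ y∈₁ = module₁ x _ c (proj₁ (∉-∪ S₁ S₂ x∉)) y∈₁ c∈₁
      ... | in₂ _ y∈₂ = module₂ x _ c (proj₂ (∉-∪ S₁ S₂ x∉)) y∈₂ c∈₂
    distinct : ∀ {a b} → S₁ a ≡ true → S₁ b ≡ false → b ≢ a
    distinct a∈ b∉ refl = true≢false (trans (sym a∈) b∉)
    trans-∪ : IsTransitiveOn (S₁ ∪ S₂)
    trans-∪ x y z x∈ y∈ z∈ xy yz with ∪-view S₁ S₂ x∈ | ∪-view S₁ S₂ y∈ | ∪-view S₁ S₂ z∈
    ... | in₁ x∈₁ | in₁ y∈₁ | in₁ z∈₁ = trans₁ x y z x∈₁ y∈₁ z∈₁ xy yz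
    ... | in₂ _ x∈₂ | in₂ _ y∈₂ | in₂ _ z∈₂ = trans₂ x y z x∈₂ y∈₂ z∈₂ xy yz
    ... | in₁ x∈₁ | in₁ y∈₁ | in₂ z∉₁ _ =
      arc-total (distinct x∈₁ z∉₁) (trans (sym (module₁ z y x z∉₁ y∈₁ x∈₁)) (arc-asym yz))
    ... | in₂ x∉₁ _ | in₁ y∈₁ | in₁ z∈₁ = trans (sym (module₁ x y z x∉₁ y∈₁ z∈₁)) xy
    ... | in₁ x∈₁ | in₂ y∉₁ _ | in₁ z∈₁ =
      contradiction (trans (sym yz) (trans (sym (module₁ y x z y∉₁ x∈₁ z∈₁)) (arc-asym xy))) true≢false
    ... | in₂ x∉₁ x∈₂ | in₂ y∉₁ y∈₂ | in₁ z∈₁ =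
      let yc = trans (sym (module₁ y z c y∉₁ z∈₁ c∈₁)) yz
      in trans (module₁ x z c x∉₁ z∈₁ c∈₁) (trans₂ x y c x∈₂ y∈₂ c∈₂ xy yc)
    ... | in₁ x∈₁ | in₂ y∉₁ y∈₂ | in₂ z∉₁ z∈₂ =
      let cy = arc-total (distinct c∈₁ y∉₁) (trans (sym (module₁ y x c y∉₁ x∈₁ c∈₁)) (arc-asym xy))
          cz = trans₂ c y z c∈₂ y∈₂ z∈₂ cy yz
      in arc-total (distinct x∈₁ z∉₁) (trans (module₁ z x c z∉₁ x∈₁ c∈₁) (arc-asym cz))
    ... | in₂ x∉₁ x∈₂ | in₁ y∈₁ | in₂ z∉₁ z∈₂ =
      let xc = trans (sym (module₁ x y c x∉₁ y∈₁ c∈₁)) xy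
          cz = arc-total (distinct c∈₁ z∉₁) (trans (sym (module₁ z y c z∉₁ y∈₁ c∈₁)) (arc-asym yz))
      in trans₂ x c z x∈₂ c∈₂ z∈₂ xc cz

  singleton : Fin n → Fin n → Bool
  singleton x y = does (y ≟ x)

  singleton-transitiveModule : ∀ x → IsTransitiveModule (singleton x)
  singleton-transitiveModule x = trans-x , module-x
    where
    ∈-singleton : ∀ {y} → singleton x y ≡ true → y ≡ x
    ∈-singleton {y} = does-true (y ≟ x)
    trans-x : IsTransitiveOn (singleton x)
    trans-x a b _ a∈ b∈ _ ab _ = contradiction (trans (∈-singleton a∈) (sym (∈-singleton b∈))) (arc-irrefl ab)
    module-x : IsModule (singleton x)
    module-x a b c _ b∈ c∈ = cong (A a) (trans (∈-singleton b∈) (sym (∈-singleton c∈)))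

  ∈-singleton-self : ∀ x → singleton x x ≡ true
  ∈-singleton-self x = dec-true (x ≟ x) refl

  infix 4 _∼ᵀ_
  _∼ᵀ_ : Fin n → Fin n → Set
  _∼ᵀ_ = _∼_ T

  InTransitiveModule : Fin n → Fin n → Set
  InTransitiveModule u v = Σ (Fin n → Bool) λ S → IsTransitiveModule S × S u ≡ true × S v ≡ true

  ∼⇒inTransitiveModule : ∀ {u v} → u ∼ᵀ v → InTransitiveModule u v
  ∼⇒inTransitiveModule {u} (inj₁ refl) = singleton u , singleton-transitiveModule u , ∈-singleton-self u , ∈-singleton-self u
  ∼⇒inTransitiveModule {u} {v} (inj₂ (inj₁ u↷v)) =
    interval u v , proj₂ (↷⇒transitiveInterval u↷v) , left∈interval u v , right∈interval u v
  ∼⇒inTransitiveModule {u} {v} (inj₂ (inj₂ v↷u)) =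
    interval v u , proj₂ (↷⇒transitiveInterval v↷u) , right∈interval v u , left∈interval v u

  inTransitiveModule⇒∼ : ∀ {u v} → InTransitiveModule u v → u ∼ᵀ v
  inTransitiveModule⇒∼ {u} {v} (S , tm , u∈ , v∈) with u ≟ v | bool-cases (A u v)
  ... | yes u≡v | _ = inj₁ u≡v
  ... | no _ | inj₁ uv = inj₂ (inj₁ (transitiveInterval⇒↷ (transitiveModule⇒transitiveInterval S tm u∈ v∈ uv)))
  ... | no u≢v | inj₂ u↛v =
    inj₂ (inj₂ (transitiveInterval⇒↷ (transitiveModule⇒transitiveInterval S tm v∈ u∈ (arc-total u≢v u↛v))))

  chain-inTransitiveModule : ∀ {x y z} → x ∼ᵀ y → y ∼ᵀ z →
    Σ (Fin n → Bool) λ S → IsTransitiveModule S × S x ≡ true × S y ≡ true × S z ≡ true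
  chain-inTransitiveModule {x} {y} {z} x∼y y∼z
    with S₁ , tm₁ , x∈₁ , y∈₁ ← ∼⇒inTransitiveModule x∼y
       | S₂ , tm₂ , y∈₂ , z∈₂ ← ∼⇒inTransitiveModule y∼z
    = S₁ ∪ S₂ , ∪-transitiveModule S₁ S₂ tm₁ tm₂ y y∈₁ y∈₂
    , cong (_∨ S₂ x) x∈₁ , cong (_∨ S₂ y) y∈₁ , trans (cong (S₁ z ∨_) z∈₂) (Boolᵖ.∨-zeroʳ (S₁ z))

  ∼-sym : ∀ {x y} → x ∼ᵀ y → y ∼ᵀ x
  ∼-sym (inj₁ x≡y) = inj₁ (sym x≡y)
  ∼-sym (inj₂ (inj₁ x↷y)) = inj₂ (inj₂ x↷y)
  ∼-sym (inj₂ (inj₂ y↷x)) = inj₂ (inj₁ y↷x)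

  ∼-trans : ∀ {x y z} → x ∼ᵀ y → y ∼ᵀ z → x ∼ᵀ z
  ∼-trans x∼y y∼z with S , tm , x∈ , _ , z∈ ← chain-inTransitiveModule x∼y y∼z = inTransitiveModule⇒∼ (S , tm , x∈ , z∈)

  ∼-arc-trans : ∀ {x y z} → x ∼ᵀ y → y ∼ᵀ z → A x y ≡ true → A y z ≡ true → A x z ≡ true
  ∼-arc-trans {x} {y} {z} x∼y y∼z with S , (trans-S , _) , x∈ , y∈ , z∈ ← chain-inTransitiveModule x∼y y∼z =
    trans-S x y z x∈ y∈ z∈

  ∼-uniform : ∀ {u r x} → u ∼ᵀ r → ¬ x ∼ᵀ u → A x u ≡ A x r
  ∼-uniform {u} {r} {x} u∼r x≁u with S , tm , u∈ , r∈ ← ∼⇒inTransitiveModule u∼r | bool-cases (S x)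
  ... | inj₁ x∈ = contradiction (inTransitiveModule⇒∼ (S , tm , x∈ , u∈)) x≁u
  ... | inj₂ x∉ = proj₂ tm x u r x∉ u∈ r∈

  _∼?_ : ∀ x y → Dec (x ∼ᵀ y)
  x ∼? y = (x ≟ y) ⊎-dec (map′ transitiveInterval⇒↷ ↷⇒transitiveInterval (transitiveInterval? x y)
                     ⊎-dec map′ transitiveInterval⇒↷ ↷⇒transitiveInterval (transitiveInterval? y x))

  ∼-isDecEquivalence : IsDecEquivalence _∼ᵀ_
  ∼-isDecEquivalence = record
    { isEquivalence = record { refl = inj₁ refl ; sym = ∼-sym ; trans = ∼-trans }
    ; _≟_ = _∼?_
    }

-- Canonical tournaments

lookupOr : ∀ {A : Set} → A → List A → ℕ → A
lookupOr d [] _ = d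
lookupOr d (x ∷ xs) zero = x
lookupOr d (x ∷ xs) (suc i) = lookupOr d xs i

blockOf : ℕ → List ℕ → ℕ
blockOf p [] = 0
blockOf p (s ∷ ss) = if does (p <? s) then 0 else suc (blockOf (p ∸ s) ss)

blockOf-offset : ∀ S j t → t < lookupOr 0 S j → blockOf (sum (take j S) + t) S ≡ j
blockOf-offset (s ∷ ss) zero t t<s rewrite dec-true (t <? s) t<s = refl
blockOf-offset (s ∷ ss) (suc j) t t<sⱼ
  rewrite +-assoc s (sum (take j ss)) t
        | dec-false (s + (sum (take j ss) + t) <? s) (≤⇒≯ (m≤m+n s _))
        | m+n∸m≡n s (sum (take j ss) + t) = cong suc (blockOf-offset ss j t t<sⱼ)

offset+size≤sum : ∀ S j → sum (take j S) + lookupOr 0 S j ≤ sum S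
offset+size≤sum [] zero = z≤n
offset+size≤sum [] (suc j) = z≤n
offset+size≤sum (s ∷ ss) zero = m≤m+n s _
offset+size≤sum (s ∷ ss) (suc j) rewrite +-assoc s (sum (take j ss)) (lookupOr 0 ss j) =
  +-monoʳ-≤ s (offset+size≤sum ss j)

fromArcRule : ∀ n (f : ℕ → ℕ → Bool) → (∀ p → f p p ≡ false) →
              (∀ p q → p ≢ q → f q p ≡ not (f p q)) → Tournament n
fromArcRule n f irrefl flip = record
  { adj = λ u v → f (toℕ u) (toℕ v)
  ; loopless = λ u → irrefl (toℕ u)
  ; tourn = λ u v u≢v → split (flip (toℕ u) (toℕ v) (u≢v ∘ toℕ-injective))
  }
  where
  split : ∀ {x y} → y ≡ not x → (x ≡ true × y ≡ false) ⊎ (x ≡ false × y ≡ true)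
  split {true} y≡ = inj₁ (refl , y≡)
  split {false} y≡ = inj₂ (refl , y≡)

tableEntry : List (List Bool) → ℕ → ℕ → Bool
tableEntry Q i j = lookupOr false (lookupOr [] Q i) j

-- Vertices 0, …, n − 1 are cut into consecutive blocks of the given sizes; inside a block arcs
-- go upwards, between blocks i < j they follow the table entry Q[i][j].
blockArc : List (List Bool) → ℕ → ℕ → ℕ → ℕ → Bool
blockArc Q i j p q =
  if does (i ℕᵖ.≟ j) then does (p <? q)
  else if does (i <? j) then tableEntry Q i j else not (tableEntry Q j i)

blockArc-irrefl : ∀ Q i p → blockArc Q i i p p ≡ false
blockArc-irrefl Q i p rewrite dec-true (i ℕᵖ.≟ i) refl = dec-false (p <? p) (n≮n p)

<-flip : ∀ p q → p ≢ q → does (q <? p) ≡ not (does (p <? q))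
<-flip p q p≢q with <-cmp p q
... | tri< p<q _ _ rewrite dec-true (p <? q) p<q = dec-false (q <? p) (<⇒≯ p<q)
... | tri≈ _ p≡q _ = contradiction p≡q p≢q
... | tri> _ _ q<p rewrite dec-true (q <? p) q<p | dec-false (p <? q) (<⇒≯ q<p) = refl

blockArc-flip : ∀ Q i j p q → p ≢ q → blockArc Q j i q p ≡ not (blockArc Q i j p q)
blockArc-flip Q i j p q p≢q with <-cmp i j
... | tri≈ _ refl _ rewrite dec-true (i ℕᵖ.≟ i) refl = <-flip p q p≢q
... | tri< i<j i≢j _ rewrite dec-false (j ℕᵖ.≟ i) (i≢j ∘ sym) | dec-false (i ℕᵖ.≟ j) i≢j
                           | dec-false (j <? i) (<⇒≯ i<j) | dec-true (i <? j) i<j = refl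
... | tri> _ i≢j j<i rewrite dec-false (j ℕᵖ.≟ i) (i≢j ∘ sym) | dec-false (i ℕᵖ.≟ j) i≢j
                           | dec-true (j <? i) j<i | dec-false (i <? j) (<⇒≯ j<i) = sym (Boolᵖ.not-involutive _)

canonical : ∀ n → List ℕ → List (List Bool) → Tournament n
canonical n S Q = fromArcRule n (λ p q → blockArc Q (blockOf p S) (blockOf q S) p q)
  (λ p → blockArc-irrefl Q (blockOf p S) p)
  (λ p q → blockArc-flip Q (blockOf p S) (blockOf q S) p q)

lookupOr-map-tabulate : ∀ {A B : Set} (d : B) (f : A → B) {r} (g : Fin r → A) i →
                        lookupOr d (map f (tabulate g)) (toℕ i) ≡ f (g i)
lookupOr-map-tabulate d f g zero = refl
lookupOr-map-tabulate d f g (suc i) = lookupOr-map-tabulate d f (g ∘ suc) i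

sum-map-tabulate : ∀ {A : Set} (f : A → ℕ) {r} (g : Fin r → A) → sum (map f (tabulate g)) ≡ ∑[ i < r ] f (g i)
sum-map-tabulate f {zero} g = refl
sum-map-tabulate f {suc r} g = cong (f (g zero) +_) (sum-map-tabulate f (g ∘ suc))

length-map-allFin : ∀ {A : Set} {r} (f : Fin r → A) → length (map f (allFin r)) ≡ r
length-map-allFin {r = r} f = trans (length-map f (allFin r)) (length-tabulate id)

fibreSize≡count : ∀ {n m} (b : Fin n → Fin m) j → fibreSize b j ≡ count (λ v → does (b v ≟ j))
fibreSize≡count b j = length-filter-tabulate (λ v → b v ≟ j) id

module Canonical {n : ℕ} (T : Tournament n) (Q : Quotient (_∼_ T)) where
  open Blocks T
  open Quotient Q renaming (size to r)

  blockSizes : List ℕ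
  blockSizes = map (fibreSize class) (allFin r)

  representativeArc : Fin r → Fin r → Bool
  representativeArc i j = A (representative i) (representative j)

  blockTable : List (List Bool)
  blockTable = map (λ i → map (representativeArc i) (allFin r)) (allFin r)

  blockSize : Fin r → ℕ
  blockSize j = count (λ v → does (class v ≟ j))

  lookup-blockSizes : ∀ j → lookupOr 0 blockSizes (toℕ j) ≡ blockSize j
  lookup-blockSizes j = trans (lookupOr-map-tabulate 0 (fibreSize class) id j) (fibreSize≡count class j)

  sum-blockSizes : sum blockSizes ≡ n
  sum-blockSizes = trans (sum-map-tabulate (fibreSize class) id)
                         (trans (sum-cong-≗ (fibreSize≡count class)) (count-fibres class))

  tableEntry-blockTable : ∀ i j → tableEntry blockTable (toℕ i) (toℕ j) ≡ A (representative i) (representative j)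
  tableEntry-blockTable i j
    rewrite lookupOr-map-tabulate [] (λ i → map (representativeArc i) (allFin r)) id i =
    lookupOr-map-tabulate false (representativeArc i) id j

  offset : Fin r → ℕ
  offset j = sum (take (toℕ j) blockSizes)

  rank : Fin n → ℕ
  rank v = count (λ w → does (class w ≟ class v) ∧ A w v)

  self-not-before-self : ∀ v → does (class v ≟ class v) ∧ A v v ≡ false
  self-not-before-self v = trans (cong (does (class v ≟ class v) ∧_) (loopless T v)) (Boolᵖ.∧-zeroʳ _)

  rank<blockSize : ∀ v → rank v < blockSize (class v)
  rank<blockSize v = count-mono-< (λ _ → proj₁ ∘ ∧-true) v (self-not-before-self v) (dec-true (class v ≟ class v) refl)

  rank-mono : ∀ {u v} → class u ≡ class v → A u v ≡ true → rank u < rank v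
  rank-mono {u} {v} u~v uv =
    count-mono-< before-u⇒before-v u (self-not-before-self u) (∧-intro (dec-true (class u ≟ class v) u~v) uv)
    where
    before-u⇒before-v : ∀ w → does (class w ≟ class u) ∧ A w u ≡ true → does (class w ≟ class v) ∧ A w v ≡ true
    before-u⇒before-v w w-before-u =
      let w~u , wu = ∧-true w-before-u
          w≡u = does-true (class w ≟ class u) w~u
      in ∧-intro (dec-true (class w ≟ class v) (trans w≡u u~v))
                 (∼-arc-trans (proj₁ (class-≡⇔≈ w u) w≡u) (proj₁ (class-≡⇔≈ u v) u~v) wu uv)

  position : Fin n → ℕ
  position v = offset (class v) + rank v

  position<n : ∀ v → position v < n
  position<n v = <-≤-trans (+-monoʳ-< (offset (class v)) (rank<blockSize v))
    (subst₂ _≤_ (cong (offset (class v) +_) (lookup-blockSizes (class v))) sum-blockSizes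
                (offset+size≤sum blockSizes (toℕ (class v))))

  relabel : Fin n → Fin n
  relabel v = fromℕ< (position<n v)

  toℕ-relabel : ∀ v → toℕ (relabel v) ≡ position v
  toℕ-relabel v = toℕ-fromℕ< (position<n v)

  blockOf-position : ∀ v → blockOf (position v) blockSizes ≡ toℕ (class v)
  blockOf-position v = blockOf-offset blockSizes (toℕ (class v)) (rank v)
    (subst (rank v <_) (sym (lookup-blockSizes (class v))) (rank<blockSize v))

  position-≡⇒class-≡ : ∀ {u v} → position u ≡ position v → class u ≡ class v
  position-≡⇒class-≡ {u} {v} pu≡pv = toℕ-injective (begin
    toℕ (class u)                ≡⟨ blockOf-position u ⟨
    blockOf (position u) blockSizes ≡⟨ cong (λ p → blockOf p blockSizes) pu≡pv ⟩
    blockOf (position v) blockSizes ≡⟨ blockOf-position v ⟩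
    toℕ (class v)                ∎)
    where open ≡-Reasoning

  position-≡⇒rank-≡ : ∀ {u v} → position u ≡ position v → rank u ≡ rank v
  position-≡⇒rank-≡ {u} {v} pu≡pv = +-cancelˡ-≡ (offset (class u)) (rank u) (rank v)
    (trans pu≡pv (cong (λ j → offset j + rank v) (sym (position-≡⇒class-≡ pu≡pv))))

  position-injective : ∀ {u v} → position u ≡ position v → u ≡ v
  position-injective {u} {v} pu≡pv with u ≟ v | bool-cases (A u v)
  ... | yes u≡v | _ = u≡v
  ... | no _ | inj₁ uv =
    contradiction (position-≡⇒rank-≡ pu≡pv) (<⇒≢ (rank-mono (position-≡⇒class-≡ pu≡pv) uv))
  ... | no u≢v | inj₂ u↛v =
    contradiction (sym (position-≡⇒rank-≡ pu≡pv)) (<⇒≢ (rank-mono (sym (position-≡⇒class-≡ pu≡pv)) (arc-total u≢v u↛v)))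

  relabel-injective : Injective _≡_ _≡_ relabel
  relabel-injective {u} {v} ru≡rv = position-injective (trans (sym (toℕ-relabel u)) (trans (cong toℕ ru≡rv) (toℕ-relabel v)))

  arc-between-blocks : ∀ u v → class u ≢ class v → A u v ≡ A (representative (class u)) (representative (class v))
  arc-between-blocks u v i≢j = begin
    A u v                                   ≡⟨ Boolᵖ.not-involutive (A u v) ⟨
    not (not (A u v))                       ≡⟨ cong not (arc-flip u v (i≢j ∘ cong class)) ⟨
    not (A v u)                             ≡⟨ cong not (∼-uniform (∼representative u) (≁ (i≢j ∘ sym))) ⟩
    not (A v (representative i))            ≡⟨ arc-flip v (representative i) v≢rᵢ ⟨
    A (representative i) v                  ≡⟨ ∼-uniform (∼representative v) (≁ (i≢j ∘ trans (sym (class-representative i)))) ⟩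
    A (representative i) (representative j) ∎
    where
    open ≡-Reasoning
    i j : Fin r
    i = class u
    j = class v
    ∼representative : ∀ w → w ∼ᵀ representative (class w)
    ∼representative w = proj₁ (class-≡⇔≈ w _) (sym (class-representative (class w)))
    ≁ : ∀ {x y} → class x ≢ class y → ¬ x ∼ᵀ y
    ≁ {x} {y} x≁y x∼y = x≁y (proj₂ (class-≡⇔≈ x y) x∼y)
    v≢rᵢ : v ≢ representative i
    v≢rᵢ v≡rᵢ = i≢j (sym (trans (cong class v≡rᵢ) (class-representative i)))

  position-< : ∀ {u v} → class u ≡ class v → A u v ≡ true → position u < position v
  position-< {u} {v} i≡j uv =
    subst (λ j → offset j + rank u < position v) (sym i≡j) (+-monoʳ-< (offset (class v)) (rank-mono i≡j uv))

  arc-within-block : ∀ u v → class u ≡ class v → A u v ≡ does (position u <? position v)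
  arc-within-block u v i≡j with u ≟ v | bool-cases (A u v)
  ... | yes refl | _ = trans (loopless T u) (sym (dec-false (position u <? position u) (n≮n _)))
  ... | no _ | inj₁ uv = trans uv (sym (dec-true (_ <? _) (position-< i≡j uv)))
  ... | no u≢v | inj₂ u↛v = trans u↛v (sym (dec-false (_ <? _) (<⇒≯ (position-< (sym i≡j) (arc-total u≢v u↛v)))))

  relabel-preserves-arcs : ∀ u v → A u v ≡ adj (canonical n blockSizes blockTable) (relabel u) (relabel v)
  relabel-preserves-arcs u v rewrite toℕ-relabel u | toℕ-relabel v | blockOf-position u | blockOf-position v
    with class u ≟ class v
  ... | yes i≡j rewrite dec-true (toℕ (class u) ℕᵖ.≟ toℕ (class v)) (cong toℕ i≡j) = arc-within-block u v i≡j
  ... | no i≢j rewrite dec-false (toℕ (class u) ℕᵖ.≟ toℕ (class v)) (i≢j ∘ toℕ-injective)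
    with <-cmp (toℕ (class u)) (toℕ (class v))
  ...   | tri< i<j _ _ rewrite dec-true (_ <? _) i<j =
          trans (arc-between-blocks u v i≢j) (sym (tableEntry-blockTable (class u) (class v)))
  ...   | tri≈ _ i≡j _ = contradiction (toℕ-injective i≡j) i≢j
  ...   | tri> _ _ j<i rewrite dec-false (_ <? _) (<⇒≯ j<i) = begin
          A u v                                            ≡⟨ arc-between-blocks u v i≢j ⟩
          A rᵢ rⱼ                                          ≡⟨ Boolᵖ.not-involutive _ ⟨
          not (not (A rᵢ rⱼ))                              ≡⟨ cong not (arc-flip rᵢ rⱼ rᵢ≢rⱼ) ⟨
          not (A rⱼ rᵢ)                                    ≡⟨ cong not (tableEntry-blockTable (class v) (class u)) ⟨
          not (tableEntry blockTable (toℕ (class v)) (toℕ (class u))) ∎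
    where
    open ≡-Reasoning
    rᵢ rⱼ : Fin n
    rᵢ = representative (class u)
    rⱼ = representative (class v)
    rᵢ≢rⱼ : rᵢ ≢ rⱼ
    rᵢ≢rⱼ e = i≢j (trans (sym (class-representative _)) (trans (cong class e) (class-representative _)))

  ≅canonical : T ≅ canonical n blockSizes blockTable
  ≅canonical = relabel , relabel-injective , relabel-preserves-arcs

length-concatMap-≤ : ∀ {A B : Set} (f : A → List B) xs b → (∀ x → x ∈ xs → length (f x) ≤ b) →
                     length (concatMap f xs) ≤ length xs * b
length-concatMap-≤ f [] b _ = z≤n
length-concatMap-≤ f (x ∷ xs) b bounded = begin
  length (f x ++ concatMap f xs)        ≡⟨ length-++ (f x) ⟩
  length (f x) + length (concatMap f xs) ≤⟨ +-mono-≤ (bounded x (here refl)) (length-concatMap-≤ f xs b (λ y y∈ → bounded y (there y∈))) ⟩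
  b + length xs * b                     ∎
  where open ≤-Reasoning

-- Enumeration of size vectors and block tables

∈-concatMap : ∀ {A B : Set} (f : A → List B) {x xs y} → x ∈ xs → y ∈ f x → y ∈ concatMap f xs
∈-concatMap f x∈ y∈ = ∈-concatMap⁺ f (Any.map (λ { refl → y∈ }) x∈)

length-cartesianProductWith : ∀ {A B C : Set} (f : A → B → C) xs ys →
                              length (cartesianProductWith f xs ys) ≡ length xs * length ys
length-cartesianProductWith f [] ys = refl
length-cartesianProductWith f (x ∷ xs) ys = begin
  length (map (f x) ys ++ cartesianProductWith f xs ys)          ≡⟨ length-++ (map (f x) ys) ⟩
  length (map (f x) ys) + length (cartesianProductWith f xs ys) ≡⟨ cong₂ _+_ (length-map (f x) ys) (length-cartesianProductWith f xs ys) ⟩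
  length ys + length xs * length ys                             ∎
  where open ≡-Reasoning

lists : ∀ {A : Set} → ℕ → List A → List (List A)
lists zero xs = [] ∷ []
lists (suc r) xs = cartesianProductWith _∷_ xs (lists r xs)

length-lists : ∀ {A : Set} r (xs : List A) → length (lists r xs) ≡ length xs ^ r
length-lists zero xs = refl
length-lists (suc r) xs = trans (length-cartesianProductWith _∷_ xs (lists r xs)) (cong (length xs *_) (length-lists r xs))

∈-lists : ∀ {A : Set} {xs : List A} {r} ys → length ys ≡ r → All (_∈ xs) ys → ys ∈ lists r xs
∈-lists [] refl [] = here refl
∈-lists (y ∷ ys) refl (y∈ ∷ ys⊆) = ∈-cartesianProductWith⁺ _∷_ y∈ (∈-lists ys refl ys⊆)

setAt : ℕ → ℕ → List ℕ → List ℕ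
setAt j a [] = []
setAt zero a (x ∷ xs) = a ∷ xs
setAt (suc j) a (x ∷ xs) = x ∷ setAt j a xs

setAt-setAt : ∀ j a b S → setAt j a (setAt j b S) ≡ setAt j a S
setAt-setAt j a b [] = refl
setAt-setAt zero a b (x ∷ xs) = refl
setAt-setAt (suc j) a b (x ∷ xs) = cong (x ∷_) (setAt-setAt j a b xs)

setAt-lookupOr : ∀ j S → setAt j (lookupOr 0 S j) S ≡ S
setAt-lookupOr j [] = refl
setAt-lookupOr zero (x ∷ xs) = refl
setAt-lookupOr (suc j) (x ∷ xs) = cong (x ∷_) (setAt-lookupOr j xs)

sum-setAt-0 : ∀ j S → sum (setAt j 0 S) + lookupOr 0 S j ≡ sum S
sum-setAt-0 j [] = refl
sum-setAt-0 zero (x ∷ xs) = +-comm (sum xs) x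
sum-setAt-0 (suc j) (x ∷ xs) = trans (+-assoc x _ _) (cong (x +_) (sum-setAt-0 j xs))

length-setAt : ∀ j a S → length (setAt j a S) ≡ length S
length-setAt j a [] = refl
length-setAt zero a (x ∷ xs) = refl
length-setAt (suc j) a (x ∷ xs) = cong suc (length-setAt j a xs)

setAt-All : ∀ {P : ℕ → Set} j a S → P a → All P S → All P (setAt j a S)
setAt-All j a [] _ [] = []
setAt-All zero a (x ∷ xs) pa (_ ∷ pxs) = pa ∷ pxs
setAt-All (suc j) a (x ∷ xs) pa (px ∷ pxs) = px ∷ setAt-All j a xs pa pxs

setAt-restore : ∀ j S → setAt j (sum S ∸ sum (setAt j 0 S)) (setAt j 0 S) ≡ S
setAt-restore j S = begin
  setAt j (sum S ∸ sum (setAt j 0 S)) (setAt j 0 S) ≡⟨ setAt-setAt j _ 0 S ⟩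
  setAt j (sum S ∸ sum (setAt j 0 S)) S             ≡⟨ cong (λ a → setAt j (a ∸ sum (setAt j 0 S)) S) (sum-setAt-0 j S) ⟨
  setAt j (sum (setAt j 0 S) + lookupOr 0 S j ∸ sum (setAt j 0 S)) S ≡⟨ cong (λ a → setAt j a S) (m+n∸m≡n (sum (setAt j 0 S)) _) ⟩
  setAt j (lookupOr 0 S j) S                        ≡⟨ setAt-lookupOr j S ⟩
  S                                                 ∎
  where open ≡-Reasoning

#above : ℕ → List ℕ → ℕ
#above M xs = length (filter (M <?_) xs)

#above-↭ : ∀ M {xs ys} → xs ↭ ys → #above M xs ≡ #above M ys
#above-↭ M xs↭ys = ↭-length (filter-↭ (M <?_) xs↭ys)

#above-accept : ∀ M {x} xs → M < x → #above M (x ∷ xs) ≡ suc (#above M xs)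
#above-accept M xs M<x = cong length (filter-accept (M <?_) M<x)

#above-reject : ∀ M {x} xs → x ≤ M → #above M (x ∷ xs) ≡ #above M xs
#above-reject M xs x≤M = cong length (filter-reject (M <?_) (≤⇒≯ x≤M))

#above-≤-drop : ∀ M j xs → sum (drop j xs) ≤ M → #above M xs ≤ j
#above-≤-drop M zero [] _ = z≤n
#above-≤-drop M zero (x ∷ xs) sum≤M = ≤-trans (≤-reflexive (#above-reject M xs (≤-trans (m≤m+n x (sum xs)) sum≤M)))
  (#above-≤-drop M zero xs (≤-trans (m≤n+m (sum xs) x) sum≤M))
#above-≤-drop M (suc j) [] _ = z≤n
#above-≤-drop M (suc j) (x ∷ xs) sum≤M with M <? x
... | yes M<x = ≤-trans (≤-reflexive (#above-accept M xs M<x)) (s≤s (#above-≤-drop M j xs sum≤M))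
... | no M≮x = ≤-trans (≤-reflexive (#above-reject M xs (≮⇒≥ M≮x))) (m≤n⇒m≤1+n (#above-≤-drop M j xs sum≤M))

length-≤-drop : ∀ j xs → All (0 <_) xs → length xs ≤ j + sum (drop j xs)
length-≤-drop zero [] [] = z≤n
length-≤-drop zero (x ∷ xs) (0<x ∷ pos) = +-mono-≤ 0<x (length-≤-drop zero xs pos)
length-≤-drop (suc j) [] [] = z≤n
length-≤-drop (suc j) (x ∷ xs) (_ ∷ pos) = s≤s (length-≤-drop j xs pos)

clear-one-above : ∀ M b S → #above M S ≤ suc b → Σ ℕ λ j → j ≤ length S × #above M (setAt j 0 S) ≤ b
clear-one-above M b [] _ = 0 , z≤n , z≤n
clear-one-above M b (x ∷ xs) #≤ with M <? x
... | yes M<x = 0 , z≤n , s≤s⁻¹ (≤-trans (≤-reflexive (sym (#above-accept M xs M<x))) #≤)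
... | no M≮x with clear-one-above M b xs (≤-trans (≤-reflexive (sym (#above-reject M xs (≮⇒≥ M≮x)))) #≤)
...   | j , j≤ , #≤′ = suc j , s≤s j≤ , ≤-trans (≤-reflexive (#above-reject M _ (≮⇒≥ M≮x))) #≤′

module SizeVectors (n M : ℕ) where

  -- An entry above M is positive, so n candidates suffice for it; this gives n ^ b rather than
  -- (n + 1) ^ b.
  small large : List ℕ
  small = downFrom (suc M)
  large = map suc (downFrom n)

  sizeVectors : ℕ → ℕ → List (List ℕ)
  sizeVectors zero b = [] ∷ []
  sizeVectors (suc r) zero = cartesianProductWith _∷_ small (sizeVectors r zero)
  sizeVectors (suc r) (suc b) =
    cartesianProductWith _∷_ small (sizeVectors r (suc b)) ++ cartesianProductWith _∷_ large (sizeVectors r b)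

  length-sizeVectors : 1 ≤ n → ∀ r b → length (sizeVectors r b) ≤ suc (suc M) ^ r * n ^ b
  length-sizeVectors 1≤n zero b = begin
    1         ≡⟨ ^-zeroˡ b ⟨
    1 ^ b     ≤⟨ ^-monoˡ-≤ b 1≤n ⟩
    n ^ b     ≡⟨ +-identityʳ (n ^ b) ⟨
    1 * n ^ b ∎
    where open ≤-Reasoning
  length-sizeVectors 1≤n (suc r) zero = begin
    length (cartesianProductWith _∷_ small (sizeVectors r zero)) ≡⟨ length-cartesianProductWith _∷_ small (sizeVectors r zero) ⟩
    length small * length (sizeVectors r zero)                   ≡⟨ cong (_* length (sizeVectors r zero)) (length-downFrom (suc M)) ⟩
    suc M * length (sizeVectors r zero)                          ≤⟨ *-mono-≤ (n≤1+n (suc M)) (length-sizeVectors 1≤n r zero) ⟩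
    suc (suc M) * (suc (suc M) ^ r * 1)                          ≡⟨ *-assoc (suc (suc M)) (suc (suc M) ^ r) 1 ⟨
    suc (suc M) ^ suc r * 1                                      ∎
    where open ≤-Reasoning
  length-sizeVectors 1≤n (suc r) (suc b) = begin
    length (cartesianProductWith _∷_ small (sizeVectors r (suc b)) ++ cartesianProductWith _∷_ large (sizeVectors r b))
      ≡⟨ length-++ (cartesianProductWith _∷_ small (sizeVectors r (suc b))) ⟩
    length (cartesianProductWith _∷_ small (sizeVectors r (suc b))) + length (cartesianProductWith _∷_ large (sizeVectors r b))
      ≡⟨ cong₂ _+_ (length-cartesianProductWith _∷_ small (sizeVectors r (suc b))) (length-cartesianProductWith _∷_ large (sizeVectors r b)) ⟩
    length small * length (sizeVectors r (suc b)) + length large * length (sizeVectors r b)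
      ≡⟨ cong₂ (λ s l → s * length (sizeVectors r (suc b)) + l * length (sizeVectors r b)) (length-downFrom (suc M)) (trans (length-map suc (downFrom n)) (length-downFrom n)) ⟩
    suc M * length (sizeVectors r (suc b)) + n * length (sizeVectors r b)
      ≤⟨ +-mono-≤ (*-monoʳ-≤ (suc M) (length-sizeVectors 1≤n r (suc b))) (*-monoʳ-≤ n (length-sizeVectors 1≤n r b)) ⟩
    suc M * (suc (suc M) ^ r * (n * n ^ b)) + n * (suc (suc M) ^ r * n ^ b)
      ≡⟨ rearrange (suc M) (suc (suc M) ^ r) n (n ^ b) ⟩
    suc (suc M) * suc (suc M) ^ r * (n * n ^ b)
      ∎
    where
    open ≤-Reasoning
    rearrange : ∀ m x s y → m * (x * (s * y)) + s * (x * y) ≡ suc m * x * (s * y)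
    rearrange = solve-∀

  small∷-∈-sizeVectors : ∀ {x r V} b → x ≤ M → V ∈ sizeVectors r b → (x ∷ V) ∈ sizeVectors (suc r) b
  small∷-∈-sizeVectors zero x≤M V∈ = ∈-cartesianProductWith⁺ _∷_ (∈-downFrom⁺ (s≤s x≤M)) V∈
  small∷-∈-sizeVectors (suc b) x≤M V∈ = ∈-++⁺ˡ (∈-cartesianProductWith⁺ _∷_ (∈-downFrom⁺ (s≤s x≤M)) V∈)

  large∷-∈-sizeVectors : ∀ {x r V} b → M < x → x ≤ n → V ∈ sizeVectors r b → (x ∷ V) ∈ sizeVectors (suc r) (suc b)
  large∷-∈-sizeVectors {suc x} {r} b _ x<n V∈ =
    ∈-++⁺ʳ (cartesianProductWith _∷_ small (sizeVectors r (suc b))) (∈-cartesianProductWith⁺ _∷_ (∈-map⁺ suc (∈-downFrom⁺ x<n)) V∈)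

  ∈-sizeVectors : ∀ b V → All (_≤ n) V → #above M V ≤ b → V ∈ sizeVectors (length V) b
  ∈-sizeVectors b [] [] _ = here refl
  ∈-sizeVectors b (x ∷ V) (x≤n ∷ V≤n) #≤ with M <? x
  ... | no M≮x = small∷-∈-sizeVectors b (≮⇒≥ M≮x)
    (∈-sizeVectors b V V≤n (≤-trans (≤-reflexive (sym (#above-reject M V (≮⇒≥ M≮x)))) #≤))
  ... | yes M<x with b | ≤-trans (≤-reflexive (sym (#above-accept M V M<x))) #≤
  ...   | suc b′ | s≤s #V≤ = large∷-∈-sizeVectors {r = length V} b′ M<x x≤n (∈-sizeVectors b′ V V≤n #V≤)

bools : List Bool
bools = true ∷ false ∷ []

∈-bools : ∀ b → b ∈ bools
∈-bools true = here refl
∈-bools false = there (here refl)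

tables : ℕ → List (List (List Bool))
tables r = lists r (lists r bools)

length-tables : ∀ r → length (tables r) ≡ (2 ^ r) ^ r
length-tables r = trans (length-lists r (lists r bools)) (cong (_^ r) (length-lists r bools))

sorted-tail-bounds : ∀ k M S → All (0 <_) S → tailSum k (sort S) ≤ M → length S ≤ suc k + M × #above M S ≤ suc k
sorted-tail-bounds k M S positive tail≤M =
  ≤-trans (≤-reflexive (sym (↭-length (sort-↭ S))))
          (≤-trans (length-≤-drop (suc k) (sort S) (All-resp-↭ (↭-sym (sort-↭ S)) positive)) (+-monoʳ-≤ (suc k) tail≤M))
  , ≤-trans (≤-reflexive (#above-↭ M (↭-sym (sort-↭ S)))) (#above-≤-drop M (suc k) (sort S) tail≤M)
  where open import Data.List.Relation.Binary.Permutation.Propositional.Properties using (All-resp-↭)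

module Candidates (k M : ℕ) where

  R : ℕ
  R = suc k + M

  #tables : ℕ
  #tables = (2 ^ R) ^ R

  C : ℕ
  C = suc R * (suc R * (suc (suc M) ^ R * #tables))

  module _ (n : ℕ) where
    open SizeVectors n M

    -- V has entry j cleared; it is restored as n minus the remaining sizes.
    withSizes : ℕ → ℕ → List ℕ → List (Tournament n)
    withSizes r j V = map (canonical n (setAt j (n ∸ sum V) V)) (tables r)

    withClearedBlock : ℕ → ℕ → List (Tournament n)
    withClearedBlock r j = concatMap (withSizes r j) (sizeVectors r k)

    withBlockCount : ℕ → List (Tournament n)
    withBlockCount r = concatMap (withClearedBlock r) (downFrom (suc R))

    candidates : List (Tournament n)
    candidates = concatMap withBlockCount (downFrom (suc R))

    #withClearedBlock : ℕ
    #withClearedBlock = suc (suc M) ^ R * n ^ k * #tables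

    length-withSizes : ∀ {r} j V → r ≤ R → length (withSizes r j V) ≤ #tables
    length-withSizes {r} j V r≤R = begin
      length (withSizes r j V) ≡⟨ length-map _ (tables r) ⟩
      length (tables r)        ≡⟨ length-tables r ⟩
      (2 ^ r) ^ r              ≤⟨ ^-monoˡ-≤ r (^-monoʳ-≤ 2 r≤R) ⟩
      (2 ^ R) ^ r              ≤⟨ ^-monoʳ-≤ (2 ^ R) {{>-nonZero (m^n>0 2 R)}} r≤R ⟩
      (2 ^ R) ^ R              ∎
      where open ≤-Reasoning

    length-withClearedBlock : 1 ≤ n → ∀ {r} j → r ≤ R → length (withClearedBlock r j) ≤ #withClearedBlock
    length-withClearedBlock 1≤n {r} j r≤R = begin
      length (withClearedBlock r j)               ≤⟨ length-concatMap-≤ (withSizes r j) (sizeVectors r k) #tables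
                                                       (λ V _ → length-withSizes j V r≤R) ⟩
      length (sizeVectors r k) * #tables          ≤⟨ *-monoˡ-≤ #tables (length-sizeVectors 1≤n r k) ⟩
      suc (suc M) ^ r * n ^ k * #tables           ≤⟨ *-monoˡ-≤ #tables (*-monoˡ-≤ (n ^ k) (^-monoʳ-≤ (suc (suc M)) r≤R)) ⟩
      #withClearedBlock                           ∎
      where open ≤-Reasoning

    length-withBlockCount : 1 ≤ n → ∀ {r} → r ≤ R → length (withBlockCount r) ≤ suc R * #withClearedBlock
    length-withBlockCount 1≤n {r} r≤R = begin
      length (withBlockCount r)                             ≤⟨ length-concatMap-≤ (withClearedBlock r) (downFrom (suc R)) _
                                                                 (λ j _ → length-withClearedBlock 1≤n j r≤R) ⟩
      length (downFrom (suc R)) * #withClearedBlock         ≡⟨ cong (_* #withClearedBlock) (length-downFrom (suc R)) ⟩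
      suc R * #withClearedBlock                             ∎
      where open ≤-Reasoning

    length-candidates : 1 ≤ n → length candidates ≤ C * n ^ k
    length-candidates 1≤n = begin
      length candidates                                     ≤⟨ length-concatMap-≤ withBlockCount (downFrom (suc R)) _
                                                                 (λ r r∈ → length-withBlockCount 1≤n (s≤s⁻¹ (∈-downFrom⁻ r∈))) ⟩
      length (downFrom (suc R)) * (suc R * #withClearedBlock) ≡⟨ cong (_* (suc R * #withClearedBlock)) (length-downFrom (suc R)) ⟩
      suc R * (suc R * #withClearedBlock)                   ≡⟨ rearrange (suc R) (suc (suc M) ^ R) (n ^ k) #tables ⟩
      C * n ^ k                                             ∎
      where
      open ≤-Reasoning
      rearrange : ∀ a b c d → a * (a * (b * c * d)) ≡ a * (a * (b * d)) * c
      rearrange = solve-∀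

    canonical-∈-candidates : ∀ S table → length S ≤ R → All (_≤ n) S → #above M S ≤ suc k → sum S ≡ n →
                             table ∈ tables (length S) → canonical n S table ∈ candidates
    canonical-∈-candidates S table r≤R S≤n #≤ sum≡n table∈
      with j , j≤r , #V≤k ← clear-one-above M k S #≤ =
      ∈-concatMap withBlockCount (∈-downFrom⁺ (s≤s r≤R))
        (∈-concatMap (withClearedBlock (length S)) (∈-downFrom⁺ (s≤s (≤-trans j≤r r≤R)))
          (∈-concatMap (withSizes (length S) j) V∈
            (subst (λ S′ → canonical n S′ table ∈ withSizes (length S) j V) restore (∈-map⁺ (canonical n (setAt j (n ∸ sum V) V)) table∈))))
      where
      V : List ℕ
      V = setAt j 0 S
      V∈ : V ∈ sizeVectors (length S) k
      V∈ = subst (λ r → V ∈ sizeVectors r k) (length-setAt j 0 S) (∈-sizeVectors k V (setAt-All j 0 S z≤n S≤n) #V≤k)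
      restore : setAt j (n ∸ sum V) V ≡ S
      restore = subst (λ m → setAt j (m ∸ sum V) V ≡ S) sum≡n (setAt-restore j S)

module BlockData {n : ℕ} (T : Tournament n) where
  open Blocks T using (∼-isDecEquivalence)
  open Quotient (quotient ∼-isDecEquivalence) public
  open Canonical T (quotient ∼-isDecEquivalence) public

  length-blockSizes : length blockSizes ≡ size
  length-blockSizes = length-map-allFin (fibreSize class)

  blockSizes-positive : All (0 <_) blockSizes
  blockSizes-positive = map⁺ (tabulate⁺ λ j → subst (0 <_) (sym (fibreSize≡count class j))
    (count-pos _ (representative j) (dec-true (class (representative j) ≟ j) (class-representative j))))

  blockSizes-≤ : All (_≤ n) blockSizes
  blockSizes-≤ = map⁺ (tabulate⁺ λ j → subst (_≤ n) (sym (fibreSize≡count class j)) (count≤ _))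

  blockTable-∈-tables : blockTable ∈ tables (length blockSizes)
  blockTable-∈-tables = subst (λ r → blockTable ∈ tables r) (sym length-blockSizes)
    (∈-lists blockTable (length-map-allFin (λ i → map (representativeArc i) (allFin size)))
      (map⁺ (tabulate⁺ λ i → ∈-lists (map (representativeArc i) (allFin size)) (length-map-allFin (representativeArc i)) (All.universal ∈-bools _))))

lemma20 : (P : Property) → Hereditary P → (k M : ℕ)
    → (∀ {n m} (T : Tournament n) → P T → (b : Fin n → Fin m) → BlockLabelling T b
    → tailSum k (blockSequence b) ≤ M)
    → Σ ℕ λ C → Σ ℕ λ N → ∀ n → N ≤ n
    → Σ (List (Tournament n)) λ reps → length reps ≤ C * n ^ k
    × (∀ (T : Tournament n) → P T → Any (λ S → T ≅ S) reps)
lemma20 P _ k M tail≤M = C , 1 , λ n 1≤n → candidates n , length-candidates n 1≤n , covered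
  where
  open Candidates k M
  covered : ∀ {n} (T : Tournament n) → P T → Any (T ≅_) (candidates n)
  covered {n} T T∈P = Any.map (λ T′≡S → subst (T ≅_) T′≡S ≅canonical)
    (canonical-∈-candidates n blockSizes blockTable (proj₁ bounds) blockSizes-≤ (proj₂ bounds) sum-blockSizes blockTable-∈-tables)
    where
    open BlockData T
    bounds : length blockSizes ≤ R × #above M blockSizes ≤ suc k
    bounds = sorted-tail-bounds k M blockSizes blockSizes-positive (tail≤M T T∈P class class-≡⇔≈)
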